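{- Let $G$ be a connected graph of size $q$ with $k\ge 1$ pendant vertices. Suppose $G$ has exactly one vertex of maximum degree $\Delta$, this vertex is not adjacent to any pendant vertex, and all other vertices of $G$ have degree at most $m<\Delta$. If $\Delta(\Delta+1)>m(2q-m+1)$, then $\chi_{la}(G)\ge k+2$.
   Context: All graphs are finite and simple; the size of a graph is its number of edges, and a pendant vertex is a vertex of degree 1. For a connected graph $G=(V,E)$ with $q=|E|$ edges, a local antimagic labeling of $G$ is a bijection $f:E\to\{1,\dots,q\}$ such that $f^+(x)\ne f^+(y)$ for every pair of adjacent vertices $x,y$, where $f^+(x)=\sum_{e\ni x} f(e)$. The local antimagic chromatic number $\chi_{la}(G)$ is the minimum, over all local antimagic labelings $f$ of $G$, of the number of distinct values taken by $f^+$. -}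

module Defs where

open import Data.Nat using (ℕ; suc; _≤_; _<_; _*_; _+_; _∸_)
import Data.Nat as N
open import Data.Fin using (Fin; toℕ)
import Data.Fin as F
open import Data.Fin.Properties using () renaming (_≟_ to _≟ᶠ_)
open import Data.List using (List; length; map; filter; allFin; deduplicate)
open import Data.Nat.ListAction using (sum)
open import Data.Product using (_×_; _,_; proj₁; proj₂; Σ; ∃)
open import Data.Sum using (_⊎_)
open import Relation.Binary.PropositionalEquality using (_≡_; _≢_)
open import Relation.Nullary using (Dec)
open import Relation.Nullary.Decidable using (_⊎-dec_)
open import Function.Bundles using (_⤖_; Bijection)

SameEdge : ∀ {n} → Fin n × Fin n → Fin n × Fin n → Set
SameEdge (a , b) (c , d) = (a ≡ c × b ≡ d) ⊎ (a ≡ d × b ≡ c)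

-- A finite simple graph with vertex set Fin n and edge set Fin q
-- (so q is the size); each edge is given by its two endpoints.
record Graph (n q : ℕ) : Set where
  field
    ends   : Fin q → Fin n × Fin n
    noLoop : ∀ e → proj₁ (ends e) ≢ proj₂ (ends e)
    simple : ∀ e e′ → SameEdge (ends e) (ends e′) → e ≡ e′

module _ {n q : ℕ} (G : Graph n q) where
  open Graph G

  Incident : Fin n → Fin q → Set
  Incident x e = (x ≡ proj₁ (ends e)) ⊎ (x ≡ proj₂ (ends e))

  incident? : ∀ x e → Dec (Incident x e)
  incident? x e = (x ≟ᶠ proj₁ (ends e)) ⊎-dec (x ≟ᶠ proj₂ (ends e))

  edgesAt : Fin n → List (Fin q)
  edgesAt x = filter (incident? x) (allFin q)

  degree : Fin n → ℕ
  degree x = length (edgesAt x)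

  Adjacent : Fin n → Fin n → Set
  Adjacent x y = ∃ λ e → SameEdge (ends e) (x , y)

  data Walk : Fin n → Fin n → Set where
    here : ∀ {x} → Walk x x
    step : ∀ {x y z} → Adjacent x y → Walk y z → Walk x z

  Connected : Set
  Connected = ∀ x y → Walk x y

  Pendant : Fin n → Set
  Pendant x = degree x ≡ 1

  pendantCount : ℕ
  pendantCount = length (filter (λ x → degree x N.≟ 1) (allFin n))

  -- A labeling is a bijection E → {1,…,q}; we encode {1,…,q} as Fin q
  -- via i ↦ toℕ i + 1.
  Labeling : Set
  Labeling = Fin q ⤖ Fin q

  label : Labeling → Fin q → ℕ
  label f e = suc (toℕ (Bijection.to f e))

  vsum : Labeling → Fin n → ℕ
  vsum f x = sum (map (label f) (edgesAt x))

  LocalAntimagic : Labeling → Set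
  LocalAntimagic f = ∀ x y → Adjacent x y → vsum f x ≢ vsum f y

  colourCount : Labeling → ℕ
  colourCount f = length (deduplicate N._≟_ (map (vsum f) (allFin n)))

  χla≥ : ℕ → Set
  χla≥ c = ∀ f → LocalAntimagic f → c ≤ colourCount f

-- The labels at a vertex of degree d are d distinct numbers in {1, …, q}, so
-- d(d+1)/2 ≤ f⁺(x) ≤ d(2q − d + 1)/2. The upper bound is increasing in d ≤ q,
-- so the inequality on Δ makes f⁺(v) strictly larger than every other vertex
-- sum. A pendant vertex carries the label of its only edge, so by local
-- antimagicness distinct pendant vertices get distinct colours, and the
-- neighbour of the heaviest pendant vertex gets a colour above all of them.
-- That neighbour is not v, since v has no pendant neighbour, so the k pendant
-- colours, the colour of that neighbour and the colour of v are all distinct.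
module Submission where

open import Data.Fin using (Fin)
import Data.Fin.Properties as Fin
open import Data.List using (List; []; _∷_; length; map; filter; allFin)
open import Data.List.Extrema.Nat using (argmax; argmax-sel; f[⊥]≤f[argmax]; f[xs]≤f[argmax])
open import Data.List.Membership.Propositional using (_∈_)
open import Data.List.Membership.Propositional.Properties
  using (∈-filter⁺; ∈-filter⁻; ∈-allFin; ∈-map⁺; ∈-deduplicate⁺)
open import Data.List.Properties using (length-map; length-filter; length-tabulate; filter-notAll)
open import Data.List.Relation.Binary.Permutation.Propositional using (↭-sym; ↭⇒↭ₛ)
open import Data.List.Relation.Binary.Permutation.Propositional.Properties using (All-resp-↭; ↭-length)
import Data.List.Relation.Binary.Permutation.Setoid.Properties as Perm
open import Data.List.Relation.Binary.Subset.Propositional using (_⊆_)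
import Data.List.Relation.Binary.Subset.Propositional.Properties as Subset
open import Data.List.Relation.Unary.All as All using (All; []; _∷_)
import Data.List.Relation.Unary.All.Properties as AllP
open import Data.List.Relation.Unary.AllPairs as AllPairs using (AllPairs; []; _∷_)
open import Data.List.Relation.Unary.Any as Any using (here; there)
open import Data.List.Relation.Unary.Sorted.TotalOrder.Properties using (Sorted⇒AllPairs)
open import Data.List.Relation.Unary.Unique.Propositional using (Unique)
import Data.List.Relation.Unary.Unique.Propositional.Properties as UniqueP
open import Data.Nat
open import Data.Nat.ListAction using (sum)
open import Data.Nat.ListAction.Properties using (sum-↭)
open import Data.Nat.Properties
open import Data.Nat.Tactic.RingSolver using (solve-∀)
open import Data.Product using (_×_; _,_; ∃; uncurry)
open import Data.Sum using (inj₁; inj₂; [_,_]′)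
open import Function using (_∘′_)
open import Function.Bundles using (Bijection)
open import Relation.Binary.Definitions using (DecidableEquality)
open import Relation.Binary.PropositionalEquality
  using (_≡_; _≢_; refl; sym; trans; cong; cong₂; subst; subst₂; setoid; module ≡-Reasoning)
open import Relation.Nullary using (¬_; ¬?; yes; no; contradiction)

open import Algebra.Properties.CommutativeSemigroup +-commutativeSemigroup
  using () renaming (interchange to +-interchange)
open import Data.List.Sort ≤-decTotalOrder using (sort; sort-↭; sort-↗)

open import Defs

∈⇒≤sum : ∀ {n ns} → n ∈ ns → n ≤ sum ns
∈⇒≤sum (here refl) = m≤m+n _ _
∈⇒≤sum {ns = m ∷ _} (there n∈ns) = ≤-trans (∈⇒≤sum n∈ns) (m≤n+m _ m)

sum-increasing-lower : ∀ b {xs} → AllPairs _<_ xs → All (b <_) xs →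
                       length xs * (2 * b + suc (length xs)) ≤ 2 * sum xs
sum-increasing-lower b {[]} [] [] = z≤n
sum-increasing-lower b {x ∷ xs} (x<xs ∷ xs↑) (b<x ∷ _) = begin
    suc d * (2 * b + suc (suc d))
  ≡⟨ expand b d ⟩
    2 * suc b + d * (2 * suc b + suc d)
  ≤⟨ +-mono-≤ (*-monoʳ-≤ 2 b<x)
              (sum-increasing-lower (suc b) xs↑ (All.map (≤-<-trans b<x) x<xs)) ⟩
    2 * x + 2 * sum xs
  ≡⟨ *-distribˡ-+ 2 x (sum xs) ⟨
    2 * (x + sum xs) ∎
  where
  open ≤-Reasoning
  d = length xs
  expand : ∀ b d → suc d * (2 * b + suc (suc d)) ≡ 2 * suc b + d * (2 * suc b + suc d)
  expand = solve-∀

sort-increasing : ∀ {xs} → Unique xs → AllPairs _<_ (sort xs)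
sort-increasing {xs} xs! = AllPairs.zipWith (uncurry ≤∧≢⇒<)
  ( Sorted⇒AllPairs ≤-totalOrder (sort-↗ xs)
  , Perm.Unique-resp-↭ (setoid ℕ) (↭⇒↭ₛ (↭-sym (sort-↭ xs))) xs!)

sum-distinct-lower : ∀ b {xs} → Unique xs → All (b <_) xs →
                     length xs * (2 * b + suc (length xs)) ≤ 2 * sum xs
sum-distinct-lower b {xs} xs! b<xs =
  subst₂ (λ l s → l * (2 * b + suc l) ≤ 2 * s) (↭-length σ) (sum-↭ σ)
    (sum-increasing-lower b (sort-increasing xs!) (All-resp-↭ (↭-sym σ) b<xs))
  where σ = sort-↭ xs

Unique-map⁺-on : ∀ {A B : Set} {P : A → Set} {f : A → B} {xs} →
                 (∀ {x y} → P x → P y → f x ≡ f y → x ≡ y) →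
                 All P xs → Unique xs → Unique (map f xs)
Unique-map⁺-on inj [] [] = []
Unique-map⁺-on inj (px ∷ pxs) (x∉xs ∷ xs!) =
  AllP.map⁺ (All.zipWith (λ (x≢y , py) fx≡fy → x≢y (inj px py fx≡fy)) (x∉xs , pxs))
  ∷ Unique-map⁺-on inj pxs xs!

sum-map-∸ : ∀ c {xs} → All (_≤ c) xs → sum (map (c ∸_) xs) + sum xs ≡ length xs * c
sum-map-∸ c {[]} [] = refl
sum-map-∸ c {x ∷ xs} (x≤c ∷ xs≤c) = begin
    (c ∸ x + sum (map (c ∸_) xs)) + (x + sum xs)
  ≡⟨ +-interchange (c ∸ x) _ x _ ⟩
    (c ∸ x + x) + (sum (map (c ∸_) xs) + sum xs)
  ≡⟨ cong₂ _+_ (m∸n+n≡m x≤c) (sum-map-∸ c xs≤c) ⟩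
    c + length xs * c ∎
  where open ≡-Reasoning

-- Reflecting x ↦ c − x turns the upper bound into the lower bound.
sum-distinct-upper : ∀ c {xs} → Unique xs → All (_< c) xs →
                     2 * sum xs + length xs * suc (length xs) ≤ 2 * (length xs * c)
sum-distinct-upper c {xs} xs! xs<c = begin
    2 * sum xs + l * suc l
  ≤⟨ +-monoʳ-≤ (2 * sum xs) reflected-lower ⟩
    2 * sum xs + 2 * sum ys
  ≡⟨ *-distribˡ-+ 2 (sum xs) (sum ys) ⟨
    2 * (sum xs + sum ys)
  ≡⟨ cong (2 *_) (trans (+-comm (sum xs) (sum ys)) (sum-map-∸ c xs≤c)) ⟩
    2 * (l * c) ∎
  where
  open ≤-Reasoning
  l = length xs
  ys = map (c ∸_) xs
  xs≤c = All.map <⇒≤ xs<c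
  reflected-lower : l * suc l ≤ 2 * sum ys
  reflected-lower = subst (λ l → l * suc l ≤ 2 * sum ys) (length-map (c ∸_) xs)
    (sum-distinct-lower 0 (Unique-map⁺-on ∸-cancelˡ-≡ xs≤c xs!)
                          (AllP.map⁺ (All.map m<n⇒0<n∸m xs<c)))

-- d ↦ d (2q − d + 1) = 2d(q + 1) − d(d + 1) is increasing on [0, q];
-- the d-term is moved to the right to avoid truncated subtraction.
sumBound-mono : ∀ {d m q} → d ≤ m → m ≤ q →
                2 * (d * suc q) ≤ m * (2 * q ∸ m + 1) + d * suc d
sumBound-mono {d} d≤m m≤q with m≤n⇒∃[o]m+o≡n d≤m | m≤n⇒∃[o]m+o≡n m≤q
... | s , refl | r , refl = begin
    2 * (d * suc (d + s + r))
  ≤⟨ m≤m+n _ (s * (s + 2 * r + 1)) ⟩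
    2 * (d * suc (d + s + r)) + s * (s + 2 * r + 1)
  ≡⟨ expand d s r ⟩
    (d + s) * (d + s + 2 * r + 1) + d * suc d
  ≡⟨ cong (λ t → (d + s) * (t + 1) + d * suc d) (2[m+r]∸m≡m+2r (d + s) r) ⟨
    (d + s) * (2 * (d + s + r) ∸ (d + s) + 1) + d * suc d ∎
  where
  open ≤-Reasoning
  expand : ∀ d s r → 2 * (d * suc (d + s + r)) + s * (s + 2 * r + 1)
                   ≡ (d + s) * (d + s + 2 * r + 1) + d * suc d
  expand = solve-∀
  2[m+r]≡m+[m+2r] : ∀ m r → 2 * (m + r) ≡ m + (m + 2 * r)
  2[m+r]≡m+[m+2r] = solve-∀
  2[m+r]∸m≡m+2r : ∀ m r → 2 * (m + r) ∸ m ≡ m + 2 * r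
  2[m+r]∸m≡m+2r m r = trans (cong (_∸ m) (2[m+r]≡m+[m+2r] m r)) (m+n∸m≡n m (m + 2 * r))

Unique⇒length≤ : ∀ {A : Set} → DecidableEquality A →
                 ∀ {xs ys : List A} → Unique xs → xs ⊆ ys → length xs ≤ length ys
Unique⇒length≤ _≟_ {[]} _ _ = z≤n
Unique⇒length≤ _≟_ {x ∷ xs} {ys} (x∉xs ∷ xs!) x∷xs⊆ys =
  <-≤-trans (s≤s (Unique⇒length≤ _≟_ xs! xs⊆ys-x)) (filter-notAll ≢x? ys x∈ys)
  where
  ≢x? = λ y → ¬? (x ≟ y)
  x∈ys = Any.map (λ x≡y x≢y → x≢y x≡y) (x∷xs⊆ys (here refl))
  xs⊆ys-x : xs ⊆ filter ≢x? ys
  xs⊆ys-x z∈xs = ∈-filter⁺ ≢x? (x∷xs⊆ys (there z∈xs)) (All.lookup x∉xs z∈xs)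

∃-argmax : ∀ {A : Set} (h : A → ℕ) {xs : List A} → 1 ≤ length xs →
           ∃ λ u → u ∈ xs × All (λ x → h x ≤ h u) xs
∃-argmax h {x ∷ xs} _ =
  argmax h x xs , [ here , there ]′ (argmax-sel h x xs) ,
  f[⊥]≤f[argmax] {f = h} x xs ∷ f[xs]≤f[argmax] {f = h} x xs

module _ {n q : ℕ} (G : Graph n q) where
  open Graph G

  degree≤size : ∀ x → degree G x ≤ q
  degree≤size x =
    ≤-trans (length-filter (incident? G x) (allFin q)) (≤-reflexive (length-tabulate (λ e → e)))

  ∈edgesAt⁺ : ∀ {x e} → Incident G x e → e ∈ edgesAt G x
  ∈edgesAt⁺ {x} {e} = ∈-filter⁺ (incident? G x) (∈-allFin e)

  ∈edgesAt⁻ : ∀ {x e} → e ∈ edgesAt G x → Incident G x e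
  ∈edgesAt⁻ {x} e∈ with _ , x~e ← ∈-filter⁻ (incident? G x) {xs = allFin q} e∈ = x~e

  incident⇒adjacent : ∀ {x y e} → Incident G x e → Incident G y e → x ≢ y → Adjacent G x y
  incident⇒adjacent (inj₁ x≡) (inj₁ y≡) x≢y = contradiction (trans x≡ (sym y≡)) x≢y
  incident⇒adjacent {e = e} (inj₁ x≡) (inj₂ y≡) _ = e , inj₁ (sym x≡ , sym y≡)
  incident⇒adjacent {e = e} (inj₂ x≡) (inj₁ y≡) _ = e , inj₂ (sym y≡ , sym x≡)
  incident⇒adjacent (inj₂ x≡) (inj₂ y≡) x≢y = contradiction (trans x≡ (sym y≡)) x≢y

  otherEnd : ∀ {x e} → Incident G x e → ∃ λ y → Incident G y e × x ≢ y
  otherEnd {e = e} (inj₁ x≡) = _ , inj₂ refl , λ x≡y → noLoop e (trans (sym x≡) x≡y)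
  otherEnd {e = e} (inj₂ x≡) = _ , inj₁ refl , λ x≡y → noLoop e (sym (trans (sym x≡) x≡y))

  pendant⇒edgesAt : ∀ {x} → Pendant G x → ∃ λ e → edgesAt G x ≡ e ∷ []
  pendant⇒edgesAt {x} deg≡1 with edgesAt G x
  ... | e ∷ [] = e , refl

  pendants : List (Fin n)
  pendants = filter (λ x → degree G x ≟ 1) (allFin n)

  pendants-pendant : All (Pendant G) pendants
  pendants-pendant = AllP.all-filter (λ x → degree G x ≟ 1) (allFin n)

  pendants-unique : Unique pendants
  pendants-unique = UniqueP.filter⁺ (λ x → degree G x ≟ 1) {xs = allFin n} (UniqueP.allFin⁺ n)

  module _ (f : Labeling G) where

    label-injective : ∀ {e e′} → label G f e ≡ label G f e′ → e ≡ e′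
    label-injective eq = Bijection.injective f (Fin.toℕ-injective (suc-injective eq))

    labelsAt : Fin n → List ℕ
    labelsAt x = map (label G f) (edgesAt G x)

    labelsAt-unique : ∀ x → Unique (labelsAt x)
    labelsAt-unique x = UniqueP.map⁺ label-injective
      (UniqueP.filter⁺ (incident? G x) {xs = allFin q} (UniqueP.allFin⁺ q))

    labelsAt-bounded : ∀ x → All (λ l → 0 < l × l < suc q) (labelsAt x)
    labelsAt-bounded x = AllP.map⁺ (All.universal (λ e → z<s , s≤s (Fin.toℕ<n (Bijection.to f e))) _)

    vsum-lower : ∀ x → degree G x * suc (degree G x) ≤ 2 * vsum G f x
    vsum-lower x =
      subst (λ d → d * suc d ≤ 2 * vsum G f x) (length-map (label G f) (edgesAt G x))
        (sum-distinct-lower 0 (labelsAt-unique x) (All.map (λ (0<l , _) → 0<l) (labelsAt-bounded x)))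

    vsum-upper : ∀ x → 2 * vsum G f x + degree G x * suc (degree G x) ≤ 2 * (degree G x * suc q)
    vsum-upper x =
      subst (λ d → 2 * vsum G f x + d * suc d ≤ 2 * (d * suc q)) (length-map (label G f) (edgesAt G x))
        (sum-distinct-upper (suc q) (labelsAt-unique x) (All.map (λ (_ , l<) → l<) (labelsAt-bounded x)))

    vsum-< : ∀ {w v m} → degree G w ≤ m → m ≤ q →
             m * (2 * q ∸ m + 1) < degree G v * suc (degree G v) → vsum G f w < vsum G f v
    vsum-< {w} {v} {m} dw≤m m≤q bound<Δ[Δ+1] = *-cancelˡ-< 2 _ _ (begin-strict
        2 * vsum G f w
      ≤⟨ +-cancelʳ-≤ (dw * suc dw) _ _ (≤-trans (vsum-upper w) (sumBound-mono dw≤m m≤q)) ⟩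
        m * (2 * q ∸ m + 1)
      <⟨ bound<Δ[Δ+1] ⟩
        degree G v * suc (degree G v)
      ≤⟨ vsum-lower v ⟩
        2 * vsum G f v ∎)
      where
      open ≤-Reasoning
      dw = degree G w

    label≤vsum : ∀ {x e} → Incident G x e → label G f e ≤ vsum G f x
    label≤vsum x~e = ∈⇒≤sum (∈-map⁺ (label G f) (∈edgesAt⁺ x~e))

    vsum-pendant : ∀ {x} → Pendant G x → ∃ λ e → Incident G x e × vsum G f x ≡ label G f e
    vsum-pendant {x} deg≡1 with e , edges≡ ← pendant⇒edgesAt deg≡1 =
      e , ∈edgesAt⁻ (subst (e ∈_) (sym edges≡) (here refl)) ,
      trans (cong (sum ∘′ map (label G f)) edges≡) (+-identityʳ (label G f e))

    length≤colourCount : ∀ {xs} → Unique (map (vsum G f) xs) → length xs ≤ colourCount G f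
    length≤colourCount {xs} sums! = subst (_≤ colourCount G f) (length-map (vsum G f) xs)
      (Unique⇒length≤ _≟_ sums! λ s∈ →
        ∈-deduplicate⁺ _≟_ (Subset.map⁺ (vsum G f) (λ {x} _ → ∈-allFin x) s∈))

    module _ (antimagic : LocalAntimagic G f) where

      vsum-pendant-injective : ∀ {x y} → Pendant G x → Pendant G y →
                               vsum G f x ≡ vsum G f y → x ≡ y
      vsum-pendant-injective {x} {y} px py sx≡sy with x Fin.≟ y
      ... | yes x≡y = x≡y
      ... | no x≢y with e , x~e , sx≡ ← vsum-pendant px | e′ , y~e′ , sy≡ ← vsum-pendant py =
        contradiction sx≡sy (antimagic x y (incident⇒adjacent x~e y~e x≢y))
        where
        e′≡e : e′ ≡ e
        e′≡e = label-injective (trans (sym sy≡) (trans (sym sx≡sy) sx≡))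
        y~e = subst (Incident G y) e′≡e y~e′

      pendant-heavier-neighbour : ∀ {x} → Pendant G x →
                                  ∃ λ y → Adjacent G y x × vsum G f x < vsum G f y
      pendant-heavier-neighbour px
        with e , x~e , sx≡ ← vsum-pendant px
        with y , y~e , x≢y ← otherEnd x~e =
        y , incident⇒adjacent y~e x~e (x≢y ∘′ sym) ,
        ≤∧≢⇒< (subst (_≤ vsum G f y) (sym sx≡) (label≤vsum y~e))
              (antimagic _ y (incident⇒adjacent x~e y~e x≢y))

      pendantCount+2≤colourCount : ∀ v → (∀ w → w ≢ v → vsum G f w < vsum G f v) →
                                   (∀ w → Adjacent G v w → ¬ Pendant G w) →
                                   1 ≤ pendantCount G → pendantCount G + 2 ≤ colourCount G f
      pendantCount+2≤colourCount v v-heaviest v-no-pendant-nbr k≥1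
        with u , u∈ , u-heaviest ← ∃-argmax (vsum G f) {pendants} k≥1
        with w , w~u , u<w ← pendant-heavier-neighbour (All.lookup pendants-pendant u∈) =
        subst (_≤ colourCount G f) (+-comm 2 (pendantCount G)) (length≤colourCount sums!)
        where
        v-not-pendant : ¬ Pendant G v
        v-not-pendant pv with y , _ , v<y ← pendant-heavier-neighbour pv =
          <-asym v<y (v-heaviest y (λ { refl → <-irrefl refl v<y }))

        w≢v : w ≢ v
        w≢v refl = v-no-pendant-nbr u w~u (All.lookup pendants-pendant u∈)

        pendants<v : All (λ x → vsum G f x < vsum G f v) pendants
        pendants<v = All.map (λ {x} px → v-heaviest x (λ { refl → v-not-pendant px })) pendants-pendant

        pendants<w : All (λ x → vsum G f x < vsum G f w) pendants
        pendants<w = All.map (λ x≤u → ≤-<-trans x≤u u<w) u-heaviest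

        sums! : Unique (map (vsum G f) (v ∷ w ∷ pendants))
        sums! = (>⇒≢ (v-heaviest w w≢v) ∷ AllP.map⁺ (All.map >⇒≢ pendants<v))
              ∷ AllP.map⁺ (All.map >⇒≢ pendants<w)
              ∷ Unique-map⁺-on vsum-pendant-injective pendants-pendant pendants-unique

theorem2p2 : ∀ {n q : ℕ} (G : Graph n q) (k m Δ : ℕ) (v : Fin n) →
    Connected G →
    pendantCount G ≡ k → 1 ≤ k →
    degree G v ≡ Δ →
    (∀ w → w ≢ v → degree G w ≤ m) → m < Δ →
    (∀ w → Adjacent G v w → ¬ Pendant G w) →
    m * (2 * q ∸ m + 1) < Δ * (Δ + 1) →
    χla≥ G (k + 2)
theorem2p2 G k m Δ v _ refl k≥1 refl deg≤m m<Δ v-no-pendant-nbr bound<Δ[Δ+1] f antimagic =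
  pendantCount+2≤colourCount G f antimagic v v-heaviest v-no-pendant-nbr k≥1
  where
  v-heaviest : ∀ w → w ≢ v → vsum G f w < vsum G f v
  v-heaviest w w≢v = vsum-< G f (deg≤m w w≢v) (≤-trans (<⇒≤ m<Δ) (degree≤size G v))
    (<-≤-trans bound<Δ[Δ+1] (≤-reflexive (cong (degree G v *_) (+-comm (degree G v) 1))))
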